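{- Let $p$ be a prime and let $G \cong \mathbb{Z}_{p^{e_1}}\oplus \mathbb{Z}_{p^{e_2}}\oplus\cdots\oplus\mathbb{Z}_{p^{e_l}}$, where $1\le e_1\le e_2\le\cdots\le e_l$ are integers. Let $A$ be a non-empty subset of $\{1,2,\dots,p^{e_l}\}$ such that the elements of $A$ are pairwise incongruent modulo $p$ and none of them is divisible by $p$. Then \[ d_A(G)\le \left\lceil \frac{1}{|A|}\Big(1+\sum_{i=1}^{l}(p^{e_i}-1)\Big)\right\rceil , \] where $\lceil x\rceil$ denotes the smallest integer $\ge x$.
   Context: For a finite abelian group $G$ (written additively) of exponent $n$ and a non-empty subset $A\subseteq\{1,\dots,n\}$, $d_A(G)$ denotes the least positive integer $t$ such that every sequence $(g_1,\dots,g_t)$ of $t$ (not necessarily distinct) elements of $G$ has a non-empty subsequence $g_{i_1},\dots,g_{i_\ell}$ (distinct indices $i_1<\dots<i_\ell$, $1\le \ell\le t$) and elements $a_1,\dots,a_\ell\in A$ (not necessarily distinct) with $\sum_{j=1}^{\ell}a_j g_{i_j}=0$ in $G$. Here $\mathbb{Z}_m$ denotes the integers modulo $m$; the exponent of the group $G$ in the claim is $p^{e_l}$. -}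

module Defs where

open import Data.Nat using (ℕ; zero; suc; _+_; _*_; _∸_; _^_; _≤_; _<_)
open import Data.Nat.DivMod using (_/_)
open import Data.Nat.Divisibility using (_∣_)
open import Data.Fin using (Fin; toℕ; fromℕ)
open import Data.Fin.Subset using (Subset; _∈_; Nonempty)
open import Data.Vec using (Vec; sum; tabulate)
open import Data.List using (List)
import Data.List.Membership.Propositional as LM
open import Data.Product using (Σ; _×_)
open import Relation.Nullary using (Dec; yes; no)
open import Data.Fin.Subset.Properties using (_∈?_)

G : (p : ℕ) {l : ℕ} (e : Fin l → ℕ) → Set
G p {l} e = (i : Fin l) → Fin (p ^ e i)

∑ : {n : ℕ} → (Fin n → ℕ) → ℕ
∑ f = sum (tabulate f)

∑∈ : {n : ℕ} → Subset n → (Fin n → ℕ) → ℕ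
∑∈ S f = ∑ (λ j → sel j)
  where
  sel : _ → ℕ
  sel j with j ∈? S
  ... | yes _ = f j
  ... | no  _ = 0

DProp : (p : ℕ) {l : ℕ} (e : Fin l → ℕ) (A : List ℕ) (t : ℕ) → Set
DProp p {l} e A t =
  (g : Fin t → G p e) →
  Σ (Subset t) λ S → Nonempty S ×
  Σ (Fin t → ℕ) λ a → ((j : Fin t) → j ∈ S → a j LM.∈ A) ×
  ((i : Fin l) → p ^ e i ∣ ∑∈ S (λ j → a j * toℕ (g j i)))

-- d_A(G) ≤ N  : the least positive t with DProp is at most N,
-- i.e. some positive t ≤ N has the property.
dA≤ : (p : ℕ) {l : ℕ} (e : Fin l → ℕ) (A : List ℕ) (N : ℕ) → Set
dA≤ p e A N = Σ ℕ λ t → 1 ≤ t × t ≤ N × DProp p e A t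

⌈_/_⌉ : ℕ → ℕ → ℕ
⌈ m / zero ⌉ = 0
⌈ m / suc n ⌉ = (m + n) / suc n

module Submission where

-- Polynomial method, with degrees measured by finite differences: φ : ℕˡ → ℤ has degree < d
-- modulo p when all its d-fold differences vanish modulo p. Since Δ^(p^e) agrees modulo p with the
-- difference of step p^e, the indicator 𝟙₀ of 0 ∈ G has degree < D = 1 + Σ (p^eᵢ - 1).
-- Let B = 0 ∷ A and u(x) = Π (x - y) over the residues y < p missing from B; u(x)·(x C k) has
-- degree < p - 1 for k < |A|, so Σ_{b ∈ B} u(b) (b C k) ≡ 0, and by Newton's expansion the
-- average φ ↦ Σ_{b ∈ B} u(b) φ(· + b g) lowers degrees by |A|. Averaging 𝟙₀ along g₁, …, g_N with
-- N |A| ≥ D yields a function ≡ 0 modulo p, whose value at 0 is nevertheless u(0)^N ≢ 0 unless some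
-- non-empty A-weighted subsequence of the gⱼ sums to 0.

open import Defs
open import Data.Nat using (ℕ; suc; _+_; _∸_; _^_; _≤_; ∣_-_∣)
open import Data.Nat.Divisibility using (_∣_)
open import Data.Nat.Primality using (Prime)
open import Data.Fin using (Fin; fromℕ; inject₁; suc)
open import Data.List using (List; length; [])
open import Data.List.Relation.Unary.All using (All)
open import Data.List.Relation.Unary.All using ([]; _∷_)
open import Data.List.Relation.Unary.AllPairs using ([]; _∷_)
open import Data.List.Relation.Unary.AllPairs using (AllPairs)
open import Relation.Binary.PropositionalEquality using (_≡_; _≢_)
open import Relation.Nullary using (¬_)
open import Data.Product using (_×_)

open import Data.Bool using (if_then_else_)
open import Data.Empty using (⊥-elim)
open import Data.Fin using (zero; toℕ)
open import Data.Fin.Subset using (Subset; inside; outside; ⊥; Nonempty) renaming (_∈_ to _∈ˢ_)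
open import Data.Fin.Subset.Properties using (_∈?_; ∉⊥)
open import Data.Integer as ℤ using (ℤ; +_; -_; _-_; 0ℤ; 1ℤ) renaming (_+_ to _+ᶻ_; _*_ to _*ᶻ_)
import Data.Integer.Properties as ℤ
open import Data.Integer.Divisibility.Signed using ()
  renaming (_∣_ to _∣ᶻ_; ∣m∣n⇒∣m+n to ∣ᶻ-+; ∣n⇒∣m*n to ∣ᶻ-*ˡ; ∣m⇒∣m*n to ∣ᶻ-*ʳ)
import Data.Integer.Divisibility.Signed as ℤ∣
open import Data.Integer.Tactic.RingSolver using (solve-∀)
open import Data.List using (_∷_)
open import Data.List.Membership.Propositional using () renaming (_∈_ to _∈ˡ_)
open import Data.List.Relation.Unary.All using ([]; _∷_)
import Data.List.Relation.Unary.All as All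
open import Data.List.Relation.Unary.AllPairs using ([]; _∷_)
import Data.List.Relation.Unary.AllPairs as AllPairs
open import Data.List.Relation.Unary.Any using (here; there)
open import Data.Nat using (zero; _*_; _<_; z≤n; s≤s; NonZero)
import Data.Nat.Properties as ℕ
open import Data.Nat.Combinatorics using (_C_; nCk+nC[k+1]≡[n+1]C[k+1]; nC1≡n; nCn≡1)
open import Data.Nat.Divisibility using (divides; ∣⇒≤; _∣?_; ∣m∣n⇒∣m+n; ∣m+n∣m⇒∣n; m%n≡0⇒n∣m)
import Data.Nat.Divisibility as ℕ∣
open import Data.Nat.DivMod using (_%_; _/_; m≡m%n+[m/n]*n; m%n<n; m≥n⇒m/n>0)
open import Data.Nat.GeneralisedArithmetic using (iterate)
open import Data.Nat.ListAction using (sum)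
open import Data.Nat.Primality using (euclidsLemma; ¬prime[0]; ¬prime[1])
open import Data.Nat.Tactic.RingSolver using () renaming (solve-∀ to ℕ-solve-∀)
open import Data.Product using (Σ; _,_)
open import Data.Sum using (_⊎_; inj₁; inj₂)
open import Data.Vec using (Vec; []; _∷_; zipWith; lookup; tabulate; replicate; here; there)
import Data.Vec as Vec
import Data.Vec.Properties as Vec
open import Data.Vec.Functional using (head; tail) renaming (_∷_ to _∷ᶠ_)
open import Level using (0ℓ)
open import Relation.Binary.Bundles using (Setoid)
open import Relation.Binary.PropositionalEquality
  using (refl; sym; trans; cong; cong₂; subst; subst₂; module ≡-Reasoning)
import Relation.Binary.Reasoning.Setoid as SetoidReasoning
open import Relation.Nullary using (yes; no)
open import Algebra.Properties.CommutativeSemigroup ℕ.+-commutativeSemigroup using ()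
  renaming (xy∙z≈xz∙y to +-swapʳ; interchange to +-interchange)
open import Algebra.Properties.CommutativeSemigroup ℤ.+-commutativeSemigroup using ()
  renaming (interchange to +ᶻ-interchange)

[k+1]*[n+1]C[k+1]≡[n+1]*nCk : ∀ n k → suc k * (suc n C suc k) ≡ suc n * (n C k)
[k+1]*[n+1]C[k+1]≡[n+1]*nCk n zero =
  trans (ℕ.*-identityˡ (suc n C 1)) (trans (nC1≡n (suc n)) (sym (ℕ.*-identityʳ (suc n))))
[k+1]*[n+1]C[k+1]≡[n+1]*nCk zero (suc k) = ℕ.*-zeroʳ (2 + k)
[k+1]*[n+1]C[k+1]≡[n+1]*nCk (suc n) (suc k) = begin
  (2 + k) * ((2 + n) C (2 + k))
    ≡⟨ cong ((2 + k) *_) (sym (nCk+nC[k+1]≡[n+1]C[k+1] (suc n) (suc k))) ⟩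
  (2 + k) * (a + b)
    ≡⟨ split k a b ⟩
  (a + (1 + k) * a) + (2 + k) * b
    ≡⟨ cong₂ (λ x y → (a + x) + y) ([k+1]*[n+1]C[k+1]≡[n+1]*nCk n k) ([k+1]*[n+1]C[k+1]≡[n+1]*nCk n (suc k)) ⟩
  (a + (1 + n) * c) + (1 + n) * d
    ≡⟨ cong (λ x → (x + (1 + n) * c) + (1 + n) * d) (sym pascal) ⟩
  ((c + d) + (1 + n) * c) + (1 + n) * d
    ≡⟨ merge n c d ⟩
  (2 + n) * (c + d)
    ≡⟨ cong ((2 + n) *_) pascal ⟩
  (2 + n) * a ∎
  where
  open ≡-Reasoning
  a b c d : ℕ
  a = suc n C suc k
  b = suc n C (2 + k)
  c = n C k
  d = n C suc k
  pascal : c + d ≡ a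
  pascal = nCk+nC[k+1]≡[n+1]C[k+1] n k
  split : ∀ k a b → (2 + k) * (a + b) ≡ (a + (1 + k) * a) + (2 + k) * b
  split = ℕ-solve-∀
  merge : ∀ n c d → ((c + d) + (1 + n) * c) + (1 + n) * d ≡ (2 + n) * (c + d)
  merge = ℕ-solve-∀

p∣pCk : ∀ {p k} → Prime p → 0 < k → k < p → p ∣ p C k
p∣pCk {suc n} {suc k} pr _ k<p
  with euclidsLemma (suc k) (suc n C suc k) pr
         (divides (n C k) (trans ([k+1]*[n+1]C[k+1]≡[n+1]*nCk n k) (ℕ.*-comm (suc n) (n C k))))
... | inj₁ p∣k+1 = ⊥-elim (ℕ.<⇒≱ k<p (∣⇒≤ p∣k+1))
... | inj₂ p∣pCk = p∣pCk

prime∣ᶻ-* : ∀ {p} → Prime p → ∀ a b → + p ∣ᶻ a *ᶻ b → + p ∣ᶻ a ⊎ + p ∣ᶻ b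
prime∣ᶻ-* pr a b p∣ab
  with euclidsLemma ℤ.∣ a ∣ ℤ.∣ b ∣ pr (subst (_ ∣_) (ℤ.abs-* a b) (ℤ∣.∣⇒∣ᵤ p∣ab))
... | inj₁ p∣a = inj₁ (ℤ∣.∣ᵤ⇒∣ p∣a)
... | inj₂ p∣b = inj₂ (ℤ∣.∣ᵤ⇒∣ p∣b)

Σ< : ℕ → (ℕ → ℤ) → ℤ
Σ< zero    f = 0ℤ
Σ< (suc n) f = f 0 +ᶻ Σ< n (λ k → f (suc k))

Σ<-cong : ∀ n {f g : ℕ → ℤ} → (∀ k → k < n → f k ≡ g k) → Σ< n f ≡ Σ< n g
Σ<-cong zero    eq = refl
Σ<-cong (suc n) eq = cong₂ _+ᶻ_ (eq 0 (s≤s z≤n)) (Σ<-cong n (λ k k<n → eq (suc k) (s≤s k<n)))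

Σ<-0 : ∀ n {f : ℕ → ℤ} → (∀ k → f k ≡ 0ℤ) → Σ< n f ≡ 0ℤ
Σ<-0 zero    eq = refl
Σ<-0 (suc n) eq = cong₂ _+ᶻ_ (eq 0) (Σ<-0 n (λ k → eq (suc k)))

Σ<-+ : ∀ n (f g : ℕ → ℤ) → Σ< n (λ k → f k +ᶻ g k) ≡ Σ< n f +ᶻ Σ< n g
Σ<-+ zero    f g = refl
Σ<-+ (suc n) f g = begin
  (f 0 +ᶻ g 0) +ᶻ Σ< n (λ k → f (suc k) +ᶻ g (suc k))
    ≡⟨ cong ((f 0 +ᶻ g 0) +ᶻ_) (Σ<-+ n (λ k → f (suc k)) (λ k → g (suc k))) ⟩
  (f 0 +ᶻ g 0) +ᶻ (Σ< n (λ k → f (suc k)) +ᶻ Σ< n (λ k → g (suc k)))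
    ≡⟨ +ᶻ-interchange (f 0) (g 0) _ _ ⟩
  (f 0 +ᶻ Σ< n (λ k → f (suc k))) +ᶻ (g 0 +ᶻ Σ< n (λ k → g (suc k)))
    ∎
  where open ≡-Reasoning

Σ<-*ˡ : ∀ n c (f : ℕ → ℤ) → c *ᶻ Σ< n f ≡ Σ< n (λ k → c *ᶻ f k)
Σ<-*ˡ zero    c f = ℤ.*-zeroʳ c
Σ<-*ˡ (suc n) c f = trans (ℤ.*-distribˡ-+ c (f 0) _) (cong (c *ᶻ f 0 +ᶻ_) (Σ<-*ˡ n c (λ k → f (suc k))))

Σ<-last : ∀ n (f : ℕ → ℤ) → Σ< (suc n) f ≡ Σ< n f +ᶻ f n
Σ<-last zero    f = trans (ℤ.+-identityʳ (f 0)) (sym (ℤ.+-identityˡ (f 0)))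
Σ<-last (suc n) f = trans (cong (f 0 +ᶻ_) (Σ<-last n (λ k → f (suc k)))) (sym (ℤ.+-assoc (f 0) _ _))

∣ᶻ-0 : ∀ {m} → m ∣ᶻ 0ℤ
∣ᶻ-0 = ℤ∣.divides 0ℤ refl

Σ<-∣ᶻ : ∀ {m} n (f : ℕ → ℤ) → (∀ k → k < n → m ∣ᶻ f k) → m ∣ᶻ Σ< n f
Σ<-∣ᶻ zero    f m∣f = ∣ᶻ-0
Σ<-∣ᶻ (suc n) f m∣f = ∣ᶻ-+ (m∣f 0 (s≤s z≤n)) (Σ<-∣ᶻ n (λ k → f (suc k)) (λ k k<n → m∣f (suc k) (s≤s k<n)))

Π< : ℕ → (ℕ → ℤ) → ℤ
Π< zero    f = 1ℤ
Π< (suc n) f = f 0 *ᶻ Π< n (λ k → f (suc k))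

Π<-zero : ∀ n (f : ℕ → ℤ) j → j < n → f j ≡ 0ℤ → Π< n f ≡ 0ℤ
Π<-zero (suc n) f zero    _         fj≡0 = cong (_*ᶻ Π< n (λ k → f (suc k))) fj≡0
Π<-zero (suc n) f (suc j) (s≤s j<n) fj≡0 =
  trans (cong (f 0 *ᶻ_) (Π<-zero n (λ k → f (suc k)) j j<n fj≡0)) (ℤ.*-zeroʳ (f 0))

Σℕ< : ℕ → (ℕ → ℕ) → ℕ
Σℕ< zero    f = 0
Σℕ< (suc n) f = f 0 + Σℕ< n (λ k → f (suc k))

Σℕ<-cong : ∀ n {f g : ℕ → ℕ} → (∀ k → k < n → f k ≡ g k) → Σℕ< n f ≡ Σℕ< n g
Σℕ<-cong zero    eq = refl
Σℕ<-cong (suc n) eq = cong₂ _+_ (eq 0 (s≤s z≤n)) (Σℕ<-cong n (λ k k<n → eq (suc k) (s≤s k<n)))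

Σℕ<-+ : ∀ n (f g : ℕ → ℕ) → Σℕ< n (λ k → f k + g k) ≡ Σℕ< n f + Σℕ< n g
Σℕ<-+ zero    f g = refl
Σℕ<-+ (suc n) f g = trans (cong (λ s → f 0 + g 0 + s) (Σℕ<-+ n (λ k → f (suc k)) (λ k → g (suc k))))
                          (+-interchange (f 0) (g 0) _ _)

Σℕ<-const : ∀ n c → Σℕ< n (λ _ → c) ≡ n * c
Σℕ<-const zero    c = refl
Σℕ<-const (suc n) c = cong (λ s → c + s) (Σℕ<-const n c)

δ : ℕ → ℕ → ℕ
δ zero    zero    = 1
δ zero    (suc _) = 0
δ (suc _) zero    = 0
δ (suc y) (suc x) = δ y x

δ-refl : ∀ y → δ y y ≡ 1
δ-refl zero    = refl
δ-refl (suc y) = δ-refl y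

δ-≢ : ∀ {y x} → y ≢ x → δ y x ≡ 0
δ-≢ {zero}  {zero}  y≢x = ⊥-elim (y≢x refl)
δ-≢ {zero}  {suc x} y≢x = refl
δ-≢ {suc y} {zero}  y≢x = refl
δ-≢ {suc y} {suc x} y≢x = δ-≢ (λ y≡x → y≢x (cong suc y≡x))

Σℕ<-δ : ∀ n y → y < n → Σℕ< n (δ y) ≡ 1
Σℕ<-δ (suc n) zero    _         = cong suc (trans (Σℕ<-const n 0) (ℕ.*-zeroʳ n))
Σℕ<-δ (suc n) (suc y) (s≤s y<n) = Σℕ<-δ n y y<n

Σ<-δ : ∀ n y (Q : ℕ → ℤ) → y < n → Σ< n (λ x → + δ y x *ᶻ Q x) ≡ Q y
Σ<-δ (suc n) zero    Q _ = begin
  1ℤ *ᶻ Q 0 +ᶻ Σ< n (λ x → 0ℤ *ᶻ Q (suc x))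
    ≡⟨ cong₂ _+ᶻ_ (ℤ.*-identityˡ (Q 0)) (Σ<-0 n (λ x → ℤ.*-zeroˡ (Q (suc x)))) ⟩
  Q 0 +ᶻ 0ℤ
    ≡⟨ ℤ.+-identityʳ (Q 0) ⟩
  Q 0 ∎
  where open ≡-Reasoning
Σ<-δ (suc n) (suc y) Q (s≤s y<n) =
  trans (cong (_+ᶻ Σ< n (λ x → + δ y x *ᶻ Q (suc x))) (ℤ.*-zeroˡ (Q 0)))
        (trans (ℤ.+-identityˡ _) (Σ<-δ n y (λ x → Q (suc x)) y<n))

infix 4 _≡_mod_
record _≡_mod_ (x y m : ℤ) : Set where
  constructor mk≡mod
  field m∣x-y : m ∣ᶻ x - y
open _≡_mod_

module _ {m : ℤ} where

  ≡⇒≡mod : ∀ {x y} → x ≡ y → x ≡ y mod m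
  ≡⇒≡mod {x} refl = mk≡mod (subst (m ∣ᶻ_) (sym (ℤ.+-inverseʳ x)) ∣ᶻ-0)

  ≡mod-trans : ∀ {x y z} → x ≡ y mod m → y ≡ z mod m → x ≡ z mod m
  ≡mod-trans {x} {y} {z} (mk≡mod x≡y) (mk≡mod y≡z) = mk≡mod (subst (m ∣ᶻ_) (telescope x y z) (∣ᶻ-+ x≡y y≡z))
    where
    telescope : ∀ x y z → (x - y) +ᶻ (y - z) ≡ x - z
    telescope = solve-∀

  ≡mod-sym : ∀ {x y} → x ≡ y mod m → y ≡ x mod m
  ≡mod-sym {x} {y} (mk≡mod x≡y) = mk≡mod (subst (m ∣ᶻ_) (neg-diff x y) (ℤ∣.∣m⇒∣-m x≡y))
    where
    neg-diff : ∀ x y → - (x - y) ≡ y - x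
    neg-diff = solve-∀

  ≡mod-+ : ∀ {x y u v} → x ≡ y mod m → u ≡ v mod m → x +ᶻ u ≡ y +ᶻ v mod m
  ≡mod-+ {x} {y} {u} {v} (mk≡mod x≡y) (mk≡mod u≡v) = mk≡mod (subst (m ∣ᶻ_) (interchange x y u v) (∣ᶻ-+ x≡y u≡v))
    where
    interchange : ∀ x y u v → (x - y) +ᶻ (u - v) ≡ (x +ᶻ u) - (y +ᶻ v)
    interchange = solve-∀

  ≡mod-- : ∀ {x y u v} → x ≡ y mod m → u ≡ v mod m → x - u ≡ y - v mod m
  ≡mod-- {x} {y} {u} {v} (mk≡mod x≡y) (mk≡mod u≡v) = mk≡mod (subst (m ∣ᶻ_) (interchange x y u v) (ℤ∣.∣m∣n⇒∣m-n x≡y u≡v))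
    where
    interchange : ∀ x y u v → (x - y) - (u - v) ≡ (x - u) - (y - v)
    interchange = solve-∀

  ≡mod-*ˡ : ∀ c {x y} → x ≡ y mod m → c *ᶻ x ≡ c *ᶻ y mod m
  ≡mod-*ˡ c {x} {y} (mk≡mod x≡y) = mk≡mod (subst (m ∣ᶻ_) (distrib c x y) (∣ᶻ-*ˡ c x≡y))
    where
    distrib : ∀ c x y → c *ᶻ (x - y) ≡ c *ᶻ x - c *ᶻ y
    distrib = solve-∀

  ∣ᶻ-resp-≡mod : ∀ {x y} → x ≡ y mod m → m ∣ᶻ y → m ∣ᶻ x
  ∣ᶻ-resp-≡mod {x} {y} (mk≡mod x≡y) m∣y = subst (m ∣ᶻ_) (cancel x y) (∣ᶻ-+ x≡y m∣y)
    where
    cancel : ∀ x y → (x - y) +ᶻ y ≡ x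
    cancel = solve-∀

  ≡mod-setoid : Setoid 0ℓ 0ℓ
  ≡mod-setoid = record
    { Carrier       = ℤ
    ; _≈_           = _≡_mod m
    ; isEquivalence = record { refl = ≡⇒≡mod refl ; sym = ≡mod-sym ; trans = ≡mod-trans }
    }

module ≡mod-Reasoning (m : ℤ) = SetoidReasoning (≡mod-setoid {m})

ΣL : List ℕ → (ℕ → ℤ) → ℤ
ΣL []      f = 0ℤ
ΣL (b ∷ B) f = f b +ᶻ ΣL B f

ΣL-cong-mod : ∀ {m} B {f g : ℕ → ℤ} → (∀ b → f b ≡ g b mod m) → ΣL B f ≡ ΣL B g mod m
ΣL-cong-mod []      f≡g = ≡⇒≡mod refl
ΣL-cong-mod (b ∷ B) f≡g = ≡mod-+ (f≡g b) (ΣL-cong-mod B f≡g)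

All-<-suc-sum : ∀ B → All (_< suc (sum B)) B
All-<-suc-sum []      = []
All-<-suc-sum (b ∷ B) = s≤s (ℕ.m≤m+n b (sum B))
                      ∷ All.map (λ b′<S → ℕ.≤-trans b′<S (s≤s (ℕ.m≤n+m (sum B) b))) (All-<-suc-sum B)

ΣL-≡0-or : ∀ {P : Set} {m} bs (w f : ℕ → ℤ) → (∀ {a} → a ∈ˡ bs → P ⊎ f a ≡ 0ℤ mod m) →
           P ⊎ ΣL bs (λ a → w a *ᶻ f a) ≡ 0ℤ mod m
ΣL-≡0-or []       w f P∨f≡0 = inj₂ (≡⇒≡mod refl)
ΣL-≡0-or (b ∷ bs) w f P∨f≡0 with P∨f≡0 (here refl) | ΣL-≡0-or bs w f (λ a∈bs → P∨f≡0 (there a∈bs))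
... | inj₁ P    | _            = inj₁ P
... | inj₂ _    | inj₁ P       = inj₁ P
... | inj₂ fb≡0 | inj₂ rest≡0 =
  inj₂ (≡mod-+ (≡mod-trans (≡mod-*ˡ (w b) fb≡0) (≡⇒≡mod (ℤ.*-zeroʳ (w b)))) rest≡0)

-- Degree via finite differences

iterate-+ : ∀ {A : Set} (F : A → A) x m n → iterate F x (m + n) ≡ iterate F (iterate F x m) n
iterate-+ F x zero    n = refl
iterate-+ F x (suc m) n = iterate-+ F (F x) m n

iterate-* : ∀ {A : Set} (F : A → A) x m n → iterate F x (m * n) ≡ iterate (λ y → iterate F y n) x m
iterate-* F x zero    n = refl
iterate-* F x (suc m) n = trans (iterate-+ F x n (m * n)) (iterate-* F (iterate F x n) m n)

module FiniteDifference (m : ℕ) {D : Set} (_⊕_ : D → D → D)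
                        (⊕-swap : ∀ x g h → (x ⊕ g) ⊕ h ≡ (x ⊕ h) ⊕ g) where

  infix 4 _≋_
  _≋_ : (D → ℤ) → (D → ℤ) → Set
  φ ≋ ψ = ∀ x → φ x ≡ ψ x mod + m

  Congruent : ((D → ℤ) → (D → ℤ)) → Set
  Congruent F = ∀ {φ ψ} → φ ≋ ψ → F φ ≋ F ψ

  iterate-congruent : ∀ {F} → Congruent F → ∀ n → Congruent (λ φ → iterate F φ n)
  iterate-congruent F-cong zero    φ≋ψ = φ≋ψ
  iterate-congruent F-cong (suc n) φ≋ψ = iterate-congruent F-cong n (F-cong φ≋ψ)

  iterate-≋ : ∀ {F G} → (∀ φ → F φ ≋ G φ) → Congruent G → ∀ n φ → iterate F φ n ≋ iterate G φ n
  iterate-≋ F≋G G-cong zero    φ x = ≡⇒≡mod refl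
  iterate-≋ {F} F≋G G-cong (suc n) φ x =
    ≡mod-trans (iterate-≋ F≋G G-cong n (F φ) x) (iterate-congruent G-cong n (F≋G φ) x)

  Δ : D → (D → ℤ) → (D → ℤ)
  Δ g φ x = φ (x ⊕ g) - φ x

  Δ-cong : ∀ g → Congruent (Δ g)
  Δ-cong g φ≋ψ x = ≡mod-- (φ≋ψ (x ⊕ g)) (φ≋ψ x)

  Δ-comm : ∀ g h φ x → Δ g (Δ h φ) x ≡ Δ h (Δ g φ) x
  Δ-comm g h φ x = begin
    (φ ((x ⊕ g) ⊕ h) - φ (x ⊕ g)) - (φ (x ⊕ h) - φ x)
      ≡⟨ cong (λ y → (φ y - φ (x ⊕ g)) - (φ (x ⊕ h) - φ x)) (⊕-swap x g h) ⟩
    (φ ((x ⊕ h) ⊕ g) - φ (x ⊕ g)) - (φ (x ⊕ h) - φ x)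
      ≡⟨ swap-middle (φ ((x ⊕ h) ⊕ g)) (φ (x ⊕ g)) (φ (x ⊕ h)) (φ x) ⟩
    (φ ((x ⊕ h) ⊕ g) - φ (x ⊕ h)) - (φ (x ⊕ g) - φ x) ∎
    where
    open ≡-Reasoning
    swap-middle : ∀ a b c d → (a - b) - (c - d) ≡ (a - c) - (b - d)
    swap-middle = solve-∀

  iterate-Δ-comm : ∀ g h k φ → iterate (Δ h) (Δ g φ) k ≋ Δ g (iterate (Δ h) φ k)
  iterate-Δ-comm g h zero    φ x = ≡⇒≡mod refl
  iterate-Δ-comm g h (suc k) φ x =
    ≡mod-trans (iterate-congruent (Δ-cong h) k (λ y → ≡⇒≡mod (Δ-comm h g φ y)) x)
               (iterate-Δ-comm g h k (Δ h φ) x)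

  Deg< : ℕ → (D → ℤ) → Set
  Deg< zero    φ = ∀ x → + m ∣ᶻ φ x
  Deg< (suc d) φ = ∀ g → Deg< d (Δ g φ)

  Deg<-resp : ∀ d {φ ψ} → φ ≋ ψ → Deg< d ψ → Deg< d φ
  Deg<-resp zero    φ≋ψ ψ<d x = ∣ᶻ-resp-≡mod (φ≋ψ x) (ψ<d x)
  Deg<-resp (suc d) φ≋ψ ψ<d g = Deg<-resp d (Δ-cong g φ≋ψ) (ψ<d g)

  Deg<-null : ∀ d {φ} → (∀ x → + m ∣ᶻ φ x) → Deg< d φ
  Deg<-null zero    m∣φ = m∣φ
  Deg<-null (suc d) m∣φ g = Deg<-null d (λ x → ℤ∣.∣m∣n⇒∣m-n (m∣φ (x ⊕ g)) (m∣φ x))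

  Deg<-suc : ∀ d {φ} → Deg< d φ → Deg< (suc d) φ
  Deg<-suc zero    φ<0 g x = ℤ∣.∣m∣n⇒∣m-n (φ<0 (x ⊕ g)) (φ<0 x)
  Deg<-suc (suc d) φ<d g = Deg<-suc d (φ<d g)

  Deg<-mono : ∀ {d e φ} → d ≤ e → Deg< d φ → Deg< e φ
  Deg<-mono {zero}  {zero}  z≤n       φ<d = φ<d
  Deg<-mono {zero}  {suc e} z≤n       φ<d = Deg<-suc e (Deg<-mono z≤n φ<d)
  Deg<-mono {suc d} {suc e} (s≤s d≤e) φ<d g = Deg<-mono d≤e (φ<d g)

  Deg<-+ : ∀ d {φ ψ} → Deg< d φ → Deg< d ψ → Deg< d (λ x → φ x +ᶻ ψ x)
  Deg<-+ zero    φ<d ψ<d x = ∣ᶻ-+ (φ<d x) (ψ<d x)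
  Deg<-+ (suc d) {φ} {ψ} φ<d ψ<d g =
    Deg<-resp d (λ x → ≡⇒≡mod (Δ-+ (φ (x ⊕ g)) (ψ (x ⊕ g)) (φ x) (ψ x))) (Deg<-+ d {Δ g φ} {Δ g ψ} (φ<d g) (ψ<d g))
    where
    Δ-+ : ∀ a b c d → (a +ᶻ b) - (c +ᶻ d) ≡ (a - c) +ᶻ (b - d)
    Δ-+ = solve-∀

  Deg<-*ˡ : ∀ d c {φ} → Deg< d φ → Deg< d (λ x → c *ᶻ φ x)
  Deg<-*ˡ zero    c φ<d x = ∣ᶻ-*ˡ c (φ<d x)
  Deg<-*ˡ (suc d) c {φ} φ<d g =
    Deg<-resp d (λ x → ≡⇒≡mod (Δ-*ˡ c (φ (x ⊕ g)) (φ x))) (Deg<-*ˡ d c {Δ g φ} (φ<d g))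
    where
    Δ-*ˡ : ∀ c a b → c *ᶻ a - c *ᶻ b ≡ c *ᶻ (a - b)
    Δ-*ˡ = solve-∀

  Deg<-Σ< : ∀ d n (F : ℕ → D → ℤ) → (∀ k → Deg< d (F k)) → Deg< d (λ x → Σ< n (λ k → F k x))
  Deg<-Σ< d zero    F F<d = Deg<-null d (λ x → ∣ᶻ-0)
  Deg<-Σ< d (suc n) F F<d = Deg<-+ d (F<d 0) (Deg<-Σ< d n (λ k → F (suc k)) (λ k → F<d (suc k)))

  Deg<-iterate-Δ : ∀ k d g {φ} → Deg< (k + d) φ → Deg< d (iterate (Δ g) φ k)
  Deg<-iterate-Δ zero    d g φ<d = φ<d
  Deg<-iterate-Δ (suc k) d g φ<d = Deg<-iterate-Δ k d g (φ<d g)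

  Deg<-iterate-Δ-≥ : ∀ {r k} d g {φ} → r ≤ k → Deg< (r + d) φ → Deg< d (iterate (Δ g) φ k)
  Deg<-iterate-Δ-≥ {r} {k} d g {φ} r≤k φ<r+d =
    subst (λ j → Deg< d (iterate (Δ g) φ j)) (ℕ.m+[n∸m]≡n r≤k)
      (subst (Deg< d) (sym (iterate-+ (Δ g) φ r (k ∸ r)))
        (Deg<-iterate-Δ (k ∸ r) d g (Deg<-mono (ℕ.m≤n+m d (k ∸ r)) (Deg<-iterate-Δ r d g {φ} φ<r+d))))

  Deg<-shift : ∀ d h {φ} → Deg< d φ → Deg< d (λ x → φ (x ⊕ h))
  Deg<-shift zero    h φ<d x = φ<d (x ⊕ h)
  Deg<-shift (suc d) h {φ} φ<d g =
    Deg<-resp d (λ x → ≡⇒≡mod (cong (λ y → φ y - φ (x ⊕ h)) (⊕-swap x g h))) (Deg<-shift d h {Δ g φ} (φ<d g))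

  -- Leibniz rule Δ(φ ψ) = (Δφ)(ψ ∘ (_⊕ g)) + φ (Δψ), with the degree of each factor dropping by one.
  Deg<-* : ∀ a b {φ ψ} → Deg< (suc a) φ → Deg< (suc b) ψ → Deg< (suc (a + b)) (λ x → φ x *ᶻ ψ x)
  Deg<-* a b {φ} {ψ} φ<a ψ<b g =
    Deg<-resp (a + b) (λ x → ≡⇒≡mod (leibniz (φ (x ⊕ g)) (ψ (x ⊕ g)) (φ x) (ψ x)))
      (Deg<-+ (a + b) (left a φ<a) (right b ψ<b))
    where
    leibniz : ∀ a b c d → a *ᶻ b - c *ᶻ d ≡ (a - c) *ᶻ b +ᶻ c *ᶻ (b - d)
    leibniz = solve-∀
    left : ∀ a → Deg< (suc a) φ → Deg< (a + b) (λ x → Δ g φ x *ᶻ ψ (x ⊕ g))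
    left zero    φ<1 = Deg<-null b (λ x → ∣ᶻ-*ʳ (ψ (x ⊕ g)) (φ<1 g x))
    left (suc a) φ<a = Deg<-* a b {Δ g φ} {λ x → ψ (x ⊕ g)} (φ<a g) (Deg<-shift (suc b) g {ψ} ψ<b)
    right : ∀ b → Deg< (suc b) ψ → Deg< (a + b) (λ x → φ x *ᶻ Δ g ψ x)
    right zero    ψ<1 = Deg<-null (a + 0) (λ x → ∣ᶻ-*ˡ (φ x) (ψ<1 g x))
    right (suc b) ψ<b = subst (λ k → Deg< k (λ x → φ x *ᶻ Δ g ψ x)) (sym (ℕ.+-suc a b))
                          (Deg<-* a b {φ} {Δ g ψ} φ<a (ψ<b g))

  Deg<-Π< : ∀ n (F : ℕ → D → ℤ) (d : ℕ → ℕ) → (∀ y → Deg< (suc (d y)) (F y)) →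
            Deg< (suc (Σℕ< n d)) (λ x → Π< n (λ y → F y x))
  Deg<-Π< zero    F d F<d g x = ∣ᶻ-0
  Deg<-Π< (suc n) F d F<d = Deg<-* (d 0) (Σℕ< n (λ k → d (suc k))) {F 0} {λ x → Π< n (λ k → F (suc k) x)} (F<d 0)
                              (Deg<-Π< n (λ k → F (suc k)) (λ k → d (suc k)) (λ y → F<d (suc y)))

  infixl 6 _⊕[_]_
  _⊕[_]_ : D → ℕ → D → D
  x ⊕[ zero  ] g = x
  x ⊕[ suc a ] g = (x ⊕[ a ] g) ⊕ g

  newton : ∀ g a M φ x → a < M → φ (x ⊕[ a ] g) ≡ Σ< M (λ k → + (a C k) *ᶻ iterate (Δ g) φ k x)
  newton g zero (suc M) φ x _ = sym (begin
    1ℤ *ᶻ φ x +ᶻ Σ< M (λ k → 0ℤ *ᶻ X (suc k))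
      ≡⟨ cong₂ _+ᶻ_ (ℤ.*-identityˡ (φ x)) (Σ<-0 M (λ k → ℤ.*-zeroˡ (X (suc k)))) ⟩
    φ x +ᶻ 0ℤ
      ≡⟨ ℤ.+-identityʳ (φ x) ⟩
    φ x ∎)
    where
    open ≡-Reasoning
    X : ℕ → ℤ
    X k = iterate (Δ g) φ k x
  newton g (suc a) (suc M) φ x (s≤s a<M) = begin
    φ (y ⊕ g)
      ≡⟨ step (φ (y ⊕ g)) (φ y) ⟩
    φ y +ᶻ Δ g φ y
      ≡⟨ cong₂ _+ᶻ_ (newton g a (suc M) φ x (ℕ.m≤n⇒m≤1+n a<M)) (newton g a M (Δ g φ) x a<M) ⟩
    (c 0 *ᶻ X 0 +ᶻ Σ< M (λ k → c (suc k) *ᶻ X (suc k))) +ᶻ Σ< M (λ k → c k *ᶻ X (suc k))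
      ≡⟨ ℤ.+-assoc (c 0 *ᶻ X 0) _ _ ⟩
    c 0 *ᶻ X 0 +ᶻ (Σ< M (λ k → c (suc k) *ᶻ X (suc k)) +ᶻ Σ< M (λ k → c k *ᶻ X (suc k)))
      ≡⟨ cong (c 0 *ᶻ X 0 +ᶻ_) (sym (Σ<-+ M _ _)) ⟩
    c 0 *ᶻ X 0 +ᶻ Σ< M (λ k → c (suc k) *ᶻ X (suc k) +ᶻ c k *ᶻ X (suc k))
      ≡⟨ cong (c 0 *ᶻ X 0 +ᶻ_) (Σ<-cong M (λ k _ → pascal k)) ⟩
    c 0 *ᶻ X 0 +ᶻ Σ< M (λ k → + (suc a C suc k) *ᶻ X (suc k))
      ∎
    where
    open ≡-Reasoning
    y : D
    y = x ⊕[ a ] g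
    X : ℕ → ℤ
    X k = iterate (Δ g) φ k x
    c : ℕ → ℤ
    c k = + (a C k)
    step : ∀ u v → u ≡ v +ᶻ (u - v)
    step = solve-∀
    pascal : ∀ k → c (suc k) *ᶻ X (suc k) +ᶻ c k *ᶻ X (suc k) ≡ + (suc a C suc k) *ᶻ X (suc k)
    pascal k = begin
      c (suc k) *ᶻ X (suc k) +ᶻ c k *ᶻ X (suc k)
        ≡⟨ sym (ℤ.*-distribʳ-+ (X (suc k)) (c (suc k)) (c k)) ⟩
      (c (suc k) +ᶻ c k) *ᶻ X (suc k)
        ≡⟨ cong (_*ᶻ X (suc k)) (sym (ℤ.pos-+ (a C suc k) (a C k))) ⟩
      + (a C suc k + a C k) *ᶻ X (suc k)
        ≡⟨ cong (λ n → + n *ᶻ X (suc k)) (trans (ℕ.+-comm (a C suc k) (a C k)) (nCk+nC[k+1]≡[n+1]C[k+1] a k)) ⟩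
      + (suc a C suc k) *ᶻ X (suc k) ∎

  newton-ΣL : ∀ (w : ℕ → ℤ) bs M g φ h → All (_< M) bs →
              ΣL bs (λ b → w b *ᶻ φ (h ⊕[ b ] g))
                ≡ Σ< M (λ k → ΣL bs (λ b → w b *ᶻ + (b C k)) *ᶻ iterate (Δ g) φ k h)
  newton-ΣL w []      M g φ h []          = sym (Σ<-0 M (λ k → ℤ.*-zeroˡ (iterate (Δ g) φ k h)))
  newton-ΣL w (b ∷ bs) M g φ h (b<M ∷ bs<M) = begin
    w b *ᶻ φ (h ⊕[ b ] g) +ᶻ ΣL bs (λ b → w b *ᶻ φ (h ⊕[ b ] g))
      ≡⟨ cong₂ _+ᶻ_ (cong (w b *ᶻ_) (newton g b M φ h b<M)) (newton-ΣL w bs M g φ h bs<M) ⟩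
    w b *ᶻ Σ< M (λ k → c k *ᶻ X k) +ᶻ Σ< M (λ k → S k *ᶻ X k)
      ≡⟨ cong (_+ᶻ Σ< M (λ k → S k *ᶻ X k)) (Σ<-*ˡ M (w b) (λ k → c k *ᶻ X k)) ⟩
    Σ< M (λ k → w b *ᶻ (c k *ᶻ X k)) +ᶻ Σ< M (λ k → S k *ᶻ X k)
      ≡⟨ sym (Σ<-+ M (λ k → w b *ᶻ (c k *ᶻ X k)) (λ k → S k *ᶻ X k)) ⟩
    Σ< M (λ k → w b *ᶻ (c k *ᶻ X k) +ᶻ S k *ᶻ X k)
      ≡⟨ Σ<-cong M (λ k _ → regroup (w b) (c k) (X k) (S k)) ⟩
    Σ< M (λ k → (w b *ᶻ c k +ᶻ S k) *ᶻ X k)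
      ∎
    where
    open ≡-Reasoning
    X : ℕ → ℤ
    X k = iterate (Δ g) φ k h
    c : ℕ → ℤ
    c k = + (b C k)
    S : ℕ → ℤ
    S k = ΣL bs (λ b → w b *ᶻ + (b C k))
    regroup : ∀ w c x s → w *ᶻ (c *ᶻ x) +ᶻ s *ᶻ x ≡ (w *ᶻ c +ᶻ s) *ᶻ x
    regroup = solve-∀

𝟙∣ : ℕ → ℕ → ℤ
𝟙∣ q x with q ∣? x
... | yes _ = 1ℤ
... | no  _ = 0ℤ

𝟙∣-periodic : ∀ q x → 𝟙∣ q (x + q) ≡ 𝟙∣ q x
𝟙∣-periodic q x with q ∣? (x + q) | q ∣? x
... | yes _      | yes _    = refl
... | no  _      | no  _    = refl
... | yes q∣x+q  | no  q∤x  = ⊥-elim (q∤x (∣m+n∣m⇒∣n (subst (q ∣_) (ℕ.+-comm x q) q∣x+q) ℕ∣.∣-refl))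
... | no  q∤x+q  | yes q∣x  = ⊥-elim (q∤x+q (∣m∣n⇒∣m+n q∣x ℕ∣.∣-refl))

module NatDifference (m : ℕ) where

  open FiniteDifference m _+_ +-swapʳ public

  ⊕[]≡+* : ∀ x a g → x ⊕[ a ] g ≡ x + a * g
  ⊕[]≡+* x zero    g = sym (ℕ.+-identityʳ x)
  ⊕[]≡+* x (suc a) g = begin
    x ⊕[ a ] g + g  ≡⟨ cong (_+ g) (⊕[]≡+* x a g) ⟩
    x + a * g + g   ≡⟨ ℕ.+-assoc x (a * g) g ⟩
    x + (a * g + g) ≡⟨ cong (λ y → x + y) (ℕ.+-comm (a * g) g) ⟩
    x + suc a * g   ∎
    where open ≡-Reasoning

  Δ-telescope : ∀ g φ x → Δ g φ x ≡ Σ< g (λ j → Δ 1 φ (x + j))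
  Δ-telescope zero    φ x = trans (cong (λ y → φ y - φ x) (ℕ.+-identityʳ x)) (ℤ.+-inverseʳ (φ x))
  Δ-telescope (suc g) φ x = begin
    φ (x + suc g) - φ x
      ≡⟨ cong (λ y → φ y - φ x) (trans (ℕ.+-suc x g) (ℕ.+-comm 1 (x + g))) ⟩
    φ (x + g + 1) - φ x
      ≡⟨ split (φ (x + g + 1)) (φ (x + g)) (φ x) ⟩
    Δ g φ x +ᶻ Δ 1 φ (x + g)
      ≡⟨ cong (_+ᶻ Δ 1 φ (x + g)) (Δ-telescope g φ x) ⟩
    Σ< g (λ j → Δ 1 φ (x + j)) +ᶻ Δ 1 φ (x + g)
      ≡⟨ sym (Σ<-last g (λ j → Δ 1 φ (x + j))) ⟩
    Σ< (suc g) (λ j → Δ 1 φ (x + j)) ∎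
    where
    open ≡-Reasoning
    split : ∀ a b c → a - c ≡ (b - c) +ᶻ (a - b)
    split = solve-∀

  -- On ℕ every difference operator is a sum of translates of Δ 1, so unit steps suffice.
  Deg<-from-Δ₁ : ∀ k φ → (∀ x → + m ∣ᶻ iterate (Δ 1) φ k x) → Deg< k φ
  Deg<-from-Δ₁ zero    φ m∣Δ₁ᵏφ = m∣Δ₁ᵏφ
  Deg<-from-Δ₁ (suc k) φ m∣Δ₁ᵏφ g = Deg<-from-Δ₁ k (Δ g φ) λ x →
    ∣ᶻ-resp-≡mod (iterate-Δ-comm g 1 k φ x)
      (subst (+ m ∣ᶻ_) (sym (Δ-telescope g (iterate (Δ 1) φ k) x))
        (Σ<-∣ᶻ g _ (λ j _ → ∣ᶻ-resp-≡mod (≡mod-sym (iterate-Δ-comm 1 1 k φ (x + j))) (m∣Δ₁ᵏφ (x + j)))))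

  Deg<-linear : ∀ y → Deg< 2 (λ x → + x - + y)
  Deg<-linear y g = Deg<-resp 1 (λ x → ≡⇒≡mod (Δ-linear x)) (λ h x → subst (+ m ∣ᶻ_) (sym (ℤ.+-inverseʳ (+ g))) ∣ᶻ-0)
    where
    cancel : ∀ a b c → ((a +ᶻ b) - c) - (a - c) ≡ b
    cancel = solve-∀
    Δ-linear : ∀ x → (+ (x + g) - + y) - (+ x - + y) ≡ + g
    Δ-linear x = trans (cong (λ z → (z - + y) - (+ x - + y)) (ℤ.pos-+ x g)) (cancel (+ x) (+ g) (+ y))

  Δ₁-binomial : ∀ k x → Δ 1 (λ y → + (y C suc k)) x ≡ + (x C k)
  Δ₁-binomial k x = begin
    + ((x + 1) C suc k) - + (x C suc k)
      ≡⟨ cong (λ y → + (y C suc k) - + (x C suc k)) (ℕ.+-comm x 1) ⟩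
    + (suc x C suc k) - + (x C suc k)
      ≡⟨ cong (λ n → + n - + (x C suc k)) (sym (nCk+nC[k+1]≡[n+1]C[k+1] x k)) ⟩
    + (x C k + x C suc k) - + (x C suc k)
      ≡⟨ cong (_- + (x C suc k)) (ℤ.pos-+ (x C k) (x C suc k)) ⟩
    (+ (x C k) +ᶻ + (x C suc k)) - + (x C suc k)
      ≡⟨ cancel (+ (x C k)) (+ (x C suc k)) ⟩
    + (x C k) ∎
    where
    open ≡-Reasoning
    cancel : ∀ a b → (a +ᶻ b) - b ≡ a
    cancel = solve-∀

  Δ₁-binomial-vanishes : ∀ k x → iterate (Δ 1) (λ y → + (y C k)) (suc k) x ≡ 0ℤ mod + m
  Δ₁-binomial-vanishes zero    x = ≡⇒≡mod refl
  Δ₁-binomial-vanishes (suc k) x =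
    ≡mod-trans (iterate-congruent (Δ-cong 1) (suc k) (λ y → ≡⇒≡mod (Δ₁-binomial k y)) x)
               (Δ₁-binomial-vanishes k x)

  Deg<-binomial : ∀ k → Deg< (suc k) (λ x → + (x C k))
  Deg<-binomial k = Deg<-from-Δ₁ (suc k) (λ x → + (x C k)) (λ x → ∣ᶻ-resp-≡mod (Δ₁-binomial-vanishes k x) ∣ᶻ-0)

module Pullback (m : ℕ) {D E : Set}
  (_⊕_ : D → D → D) (⊕-swap : ∀ x g h → (x ⊕ g) ⊕ h ≡ (x ⊕ h) ⊕ g)
  (_⊞_ : E → E → E) (⊞-swap : ∀ x g h → (x ⊞ g) ⊞ h ≡ (x ⊞ h) ⊞ g)
  (π : E → D) (π-hom : ∀ x g → π (x ⊞ g) ≡ π x ⊕ π g) where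

  module DΔ = FiniteDifference m _⊕_ ⊕-swap
  module EΔ = FiniteDifference m _⊞_ ⊞-swap

  Deg<-∘ : ∀ k φ → DΔ.Deg< k φ → EΔ.Deg< k (λ x → φ (π x))
  Deg<-∘ zero    φ φ<k x = φ<k (π x)
  Deg<-∘ (suc k) φ φ<k g = EΔ.Deg<-resp k (λ x → ≡⇒≡mod (cong (λ y → φ y - φ (π x)) (π-hom x g)))
                             (Deg<-∘ k (DΔ.Δ (π g) φ) (φ<k (π g)))

infixl 6 _⊕ᵛ_
_⊕ᵛ_ : ∀ {l} → Vec ℕ l → Vec ℕ l → Vec ℕ l
_⊕ᵛ_ = zipWith _+_

⊕ᵛ-swap : ∀ {l} (x g h : Vec ℕ l) → (x ⊕ᵛ g) ⊕ᵛ h ≡ (x ⊕ᵛ h) ⊕ᵛ g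
⊕ᵛ-swap []       []       []       = refl
⊕ᵛ-swap (x ∷ xs) (g ∷ gs) (h ∷ hs) = cong₂ _∷_ (+-swapʳ x g h) (⊕ᵛ-swap xs gs hs)

module VecDifference (m l : ℕ) = FiniteDifference m (_⊕ᵛ_ {l}) ⊕ᵛ-swap

lookup-⊕ᵛ[] : ∀ {m l} (h : Vec ℕ l) a g i → lookup (VecDifference._⊕[_]_ m l h a g) i ≡ lookup h i + a * lookup g i
lookup-⊕ᵛ[] h zero    g i = sym (ℕ.+-identityʳ (lookup h i))
lookup-⊕ᵛ[] {m} h (suc a) g i = begin
  lookup (h ⊕[ a ] g ⊕ᵛ g) i
    ≡⟨ Vec.lookup-zipWith _+_ i (h ⊕[ a ] g) g ⟩
  lookup (h ⊕[ a ] g) i + lookup g i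
    ≡⟨ cong (_+ lookup g i) (lookup-⊕ᵛ[] {m} h a g i) ⟩
  lookup h i + a * lookup g i + lookup g i
    ≡⟨ ℕ.+-assoc (lookup h i) (a * lookup g i) (lookup g i) ⟩
  lookup h i + (a * lookup g i + lookup g i)
    ≡⟨ cong (λ y → lookup h i + y) (ℕ.+-comm (a * lookup g i) (lookup g i)) ⟩
  lookup h i + suc a * lookup g i ∎
  where
  open ≡-Reasoning
  open VecDifference m _ using (_⊕[_]_)

𝟙∣ᵛ : ∀ {l} → (Fin l → ℕ) → Vec ℕ l → ℤ
𝟙∣ᵛ q []       = 1ℤ
𝟙∣ᵛ q (x ∷ xs) = 𝟙∣ (q zero) x *ᶻ 𝟙∣ᵛ (λ i → q (suc i)) xs

𝟙∣-cases : ∀ q x → 𝟙∣ q x ≡ 0ℤ ⊎ (𝟙∣ q x ≡ 1ℤ × q ∣ x)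
𝟙∣-cases q x with q ∣? x
... | yes q∣x = inj₂ (refl , q∣x)
... | no  _   = inj₁ refl

𝟙∣-0 : ∀ q → 𝟙∣ q 0 ≡ 1ℤ
𝟙∣-0 q with q ∣? 0
... | yes _  = refl
... | no q∤0 = ⊥-elim (q∤0 (q ℕ∣.∣0))

𝟙∣ᵛ-cases : ∀ {l} q (x : Vec ℕ l) → 𝟙∣ᵛ q x ≡ 0ℤ ⊎ (∀ i → q i ∣ lookup x i)
𝟙∣ᵛ-cases q []       = inj₂ (λ ())
𝟙∣ᵛ-cases q (x ∷ xs) with 𝟙∣-cases (q zero) x | 𝟙∣ᵛ-cases (λ i → q (suc i)) xs
... | inj₁ 𝟙≡0       | _          = inj₁ (cong (_*ᶻ 𝟙∣ᵛ (λ i → q (suc i)) xs) 𝟙≡0)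
... | inj₂ (𝟙≡1 , _) | inj₁ 𝟙ᵛ≡0  = inj₁ (cong₂ _*ᶻ_ 𝟙≡1 𝟙ᵛ≡0)
... | inj₂ (_ , q∣x) | inj₂ q∣xs  = inj₂ λ { zero → q∣x ; (suc i) → q∣xs i }

𝟙∣ᵛ-replicate-0 : ∀ {l} q → 𝟙∣ᵛ q (replicate l 0) ≡ 1ℤ
𝟙∣ᵛ-replicate-0 {zero}  q = refl
𝟙∣ᵛ-replicate-0 {suc l} q = cong₂ _*ᶻ_ (𝟙∣-0 (q zero)) (𝟙∣ᵛ-replicate-0 (λ i → q (suc i)))

module _ (m l : ℕ) where

  private
    head-⊕ᵛ : ∀ (x g : Vec ℕ (suc l)) → Vec.head (x ⊕ᵛ g) ≡ Vec.head x + Vec.head g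
    head-⊕ᵛ (x ∷ _) (g ∷ _) = refl
    tail-⊕ᵛ : ∀ (x g : Vec ℕ (suc l)) → Vec.tail (x ⊕ᵛ g) ≡ Vec.tail x ⊕ᵛ Vec.tail g
    tail-⊕ᵛ (_ ∷ xs) (_ ∷ gs) = refl

  open Pullback m _+_ +-swapʳ _⊕ᵛ_ ⊕ᵛ-swap Vec.head head-⊕ᵛ public using ()
    renaming (Deg<-∘ to Deg<-head)
  open Pullback m _⊕ᵛ_ ⊕ᵛ-swap _⊕ᵛ_ ⊕ᵛ-swap Vec.tail tail-⊕ᵛ public using ()
    renaming (Deg<-∘ to Deg<-tail)

-- Modulo a prime

module ModPrime (n : ℕ) (prime : Prime (suc n)) where

  p : ℕ
  p = suc n

  module ℕΔ = NatDifference p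
  open ℕΔ using (Δ; Deg<; Deg<-iterate-Δ; _⊕[_]_)

  frobenius : ∀ g φ x → iterate (Δ g) φ p x ≡ φ (x + p * g) - φ x mod + p
  frobenius g φ x = mk≡mod (subst (+ p ∣ᶻ_) (sym difference) (ℤ∣.∣m⇒∣-m p∣middle))
    where
    X : ℕ → ℤ
    X k = iterate (Δ g) φ k x
    term : ℕ → ℤ
    term k = + (p C suc k) *ᶻ X (suc k)
    middle : ℤ
    middle = Σ< n term
    p∣middle : + p ∣ᶻ middle
    p∣middle = Σ<-∣ᶻ n term λ k k<n →
      ∣ᶻ-*ʳ (X (suc k)) (ℤ∣.∣ᵤ⇒∣ {+ p} {+ (p C suc k)} (p∣pCk prime (s≤s z≤n) (s≤s k<n)))
    expansion : φ (x + p * g) ≡ 1ℤ *ᶻ φ x +ᶻ (middle +ᶻ + (p C p) *ᶻ X p)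
    expansion = begin
      φ (x + p * g)          ≡⟨ cong φ (sym (ℕΔ.⊕[]≡+* x p g)) ⟩
      φ (x ⊕[ p ] g)         ≡⟨ ℕΔ.newton g p (suc p) φ x (ℕ.n<1+n p) ⟩
      1ℤ *ᶻ φ x +ᶻ Σ< p term ≡⟨ cong (1ℤ *ᶻ φ x +ᶻ_) (Σ<-last n term) ⟩
      1ℤ *ᶻ φ x +ᶻ (middle +ᶻ + (p C p) *ᶻ X p) ∎
      where open ≡-Reasoning
    cancel : ∀ d a b → b - ((1ℤ *ᶻ a +ᶻ (d +ᶻ 1ℤ *ᶻ b)) - a) ≡ - d
    cancel = solve-∀
    difference : X p - (φ (x + p * g) - φ x) ≡ - middle
    difference rewrite expansion | nCn≡1 p = cancel middle (φ x) (X p)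

  frobenius-^ : ∀ e g φ x → iterate (Δ g) φ (p ^ e) x ≡ φ (x + p ^ e * g) - φ x mod + p
  frobenius-^ zero    g φ x = ≡⇒≡mod (cong (λ y → φ (x + y) - φ x) (sym (ℕ.*-identityˡ g)))
  frobenius-^ (suc e) g φ x = begin
      iterate (Δ g) φ (p * p ^ e) x
    ≡⟨ cong (λ ψ → ψ x) (iterate-* (Δ g) φ p (p ^ e)) ⟩
      iterate (λ ψ → iterate (Δ g) ψ (p ^ e)) φ p x
    ≈⟨ ℕΔ.iterate-≋ (frobenius-^ e g) (ℕΔ.Δ-cong (p ^ e * g)) p φ x ⟩
      iterate (Δ (p ^ e * g)) φ p x
    ≈⟨ frobenius (p ^ e * g) φ x ⟩
      φ (x + p * (p ^ e * g)) - φ x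
    ≡⟨ cong (λ y → φ (x + y) - φ x) (sym (ℕ.*-assoc p (p ^ e) g)) ⟩
      φ (x + p ^ suc e * g) - φ x
    ∎
    where open ≡mod-Reasoning (+ p)

  Deg<-𝟙∣ : ∀ e → Deg< (p ^ e) (𝟙∣ (p ^ e))
  Deg<-𝟙∣ e = ℕΔ.Deg<-from-Δ₁ (p ^ e) (𝟙∣ (p ^ e)) λ x →
    ∣ᶻ-resp-≡mod (≡mod-trans (frobenius-^ e 1 (𝟙∣ (p ^ e)) x) (≡⇒≡mod (vanishes x))) ∣ᶻ-0
    where
    vanishes : ∀ x → 𝟙∣ (p ^ e) (x + p ^ e * 1) - 𝟙∣ (p ^ e) x ≡ 0ℤ
    vanishes x rewrite ℕ.*-identityʳ (p ^ e) | 𝟙∣-periodic (p ^ e) x = ℤ.+-inverseʳ (𝟙∣ (p ^ e) x)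

  Deg<p-periodic : ∀ {φ} → Deg< p φ → ∀ x → φ (x + p) ≡ φ x mod + p
  Deg<p-periodic {φ} φ<p x = subst (λ y → φ (x + y) ≡ φ x mod + p) (ℕ.*-identityʳ p)
    (mk≡mod (∣ᶻ-resp-≡mod (≡mod-sym (frobenius 1 φ x)) (Deg<-iterate-Δ p 0 1 {φ} φ<p+0 x)))
    where
    φ<p+0 : Deg< (p + 0) φ
    φ<p+0 = subst (λ d → Deg< d φ) (sym (ℕ.+-identityʳ p)) φ<p

  Deg<p-≡mod-% : ∀ {φ} → Deg< p φ → ∀ a → φ a ≡ φ (a % p) mod + p
  Deg<p-≡mod-% {φ} φ<p a = subst (λ b → φ b ≡ φ (a % p) mod + p) (sym (m≡m%n+[m/n]*n a p)) (shifts (a / p) (a % p))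
    where
    shifts : ∀ k r → φ (r + k * p) ≡ φ r mod + p
    shifts zero    r = ≡⇒≡mod (cong φ (ℕ.+-identityʳ r))
    shifts (suc k) r = ≡mod-trans (≡⇒≡mod (cong φ (shuffle r k)))
                         (≡mod-trans (Deg<p-periodic {φ} φ<p (r + k * p)) (shifts k r))
      where
      shuffle : ∀ r k → r + suc k * p ≡ (r + k * p) + p
      shuffle r k = trans (cong (λ y → r + y) (ℕ.+-comm p (k * p))) (sym (ℕ.+-assoc r (k * p) p))

  -- The partial sums of φ have degree < p, and Frobenius turns their p-th difference into a full period.
  Deg<-Σ<-period : ∀ {φ} → Deg< n φ → + p ∣ᶻ Σ< p φ
  Deg<-Σ<-period {φ} φ<n = ∣ᶻ-resp-≡mod period (Deg<-iterate-Δ n 0 1 {φ} φ<n+0 0)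
    where
    F : ℕ → ℤ
    F x = Σ< x φ
    Δ₁F : ∀ y → Δ 1 F y ≡ φ y
    Δ₁F y rewrite ℕ.+-comm y 1 | Σ<-last y φ = cancel (Σ< y φ) (φ y)
      where
      cancel : ∀ a b → (a +ᶻ b) - a ≡ b
      cancel = solve-∀
    φ<n+0 : Deg< (n + 0) φ
    φ<n+0 = subst (λ d → Deg< d φ) (sym (ℕ.+-identityʳ n)) φ<n
    period : Σ< p φ ≡ iterate (Δ 1) φ n 0 mod + p
    period = begin
      Σ< p φ                  ≡⟨ sym (ℤ.+-identityʳ (Σ< p φ)) ⟩
      Σ< p φ - 0ℤ             ≡⟨ cong (λ y → Σ< y φ - 0ℤ) (sym (ℕ.*-identityʳ p)) ⟩
      F (0 + p * 1) - F 0     ≈⟨ ≡mod-sym (frobenius 1 F 0) ⟩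
      iterate (Δ 1) F p 0     ≈⟨ ℕΔ.iterate-congruent (ℕΔ.Δ-cong 1) n (λ y → ≡⇒≡mod (Δ₁F y)) 0 ⟩
      iterate (Δ 1) φ n 0     ∎
      where open ≡mod-Reasoning (+ p)

  Deg<-𝟙∣ᵛ : ∀ {l} (e : Fin l → ℕ) →
    VecDifference.Deg< p l (suc (∑ (λ i → p ^ e i ∸ 1))) (𝟙∣ᵛ (λ i → p ^ e i))
  Deg<-𝟙∣ᵛ {zero}  e [] [] = ∣ᶻ-0
  Deg<-𝟙∣ᵛ {suc l} e = VΔ.Deg<-resp (suc (∑ (λ i → p ^ e i ∸ 1))) split
    (VΔ.Deg<-* (q₀ ∸ 1) (∑ (λ i → q′ i ∸ 1)) {λ x → 𝟙∣ q₀ (Vec.head x)} {λ x → 𝟙∣ᵛ q′ (Vec.tail x)}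
      head-part tail-part)
    where
    module VΔ = VecDifference p (suc l)
    q₀ : ℕ
    q₀ = p ^ e zero
    q′ : Fin l → ℕ
    q′ i = p ^ e (suc i)
    head-part : VΔ.Deg< (suc (q₀ ∸ 1)) (λ x → 𝟙∣ q₀ (Vec.head x))
    head-part = Deg<-head p l (suc (q₀ ∸ 1)) (𝟙∣ q₀)
      (subst (λ d → Deg< d (𝟙∣ q₀)) (sym (ℕ.suc-pred q₀ {{ℕ.m^n≢0 p (e zero)}})) (Deg<-𝟙∣ (e zero)))
    tail-part : VΔ.Deg< (suc (∑ (λ i → q′ i ∸ 1))) (λ x → 𝟙∣ᵛ q′ (Vec.tail x))
    tail-part = Deg<-tail p l (suc (∑ (λ i → q′ i ∸ 1))) (𝟙∣ᵛ q′) (Deg<-𝟙∣ᵛ (λ i → e (suc i)))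
    split : ∀ x → 𝟙∣ᵛ (λ i → p ^ e i) x ≡ 𝟙∣ q₀ (Vec.head x) *ᶻ 𝟙∣ᵛ q′ (Vec.tail x) mod + p
    split (_ ∷ _) = ≡⇒≡mod refl

  Distinct : List ℕ → Set
  Distinct = AllPairs (λ a b → a % p ≢ b % p)

  count : List ℕ → ℕ → ℕ
  count []      y = 0
  count (b ∷ B) y = δ (b % p) y + count B y

  Σℕ<-count : ∀ B → Σℕ< p (count B) ≡ length B
  Σℕ<-count []      = trans (Σℕ<-const p 0) (ℕ.*-zeroʳ p)
  Σℕ<-count (b ∷ B) = trans (Σℕ<-+ p (δ (b % p)) (count B))
                            (cong₂ _+_ (Σℕ<-δ p (b % p) (m%n<n b p)) (Σℕ<-count B))

  Σ<-count : ∀ B (Q : ℕ → ℤ) → Σ< p (λ x → + count B x *ᶻ Q x) ≡ ΣL B (λ b → Q (b % p))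
  Σ<-count []      Q = Σ<-0 p (λ x → ℤ.*-zeroˡ (Q x))
  Σ<-count (b ∷ B) Q = begin
    Σ< p (λ x → + (δ (b % p) x + count B x) *ᶻ Q x)
      ≡⟨ Σ<-cong p (λ x _ → trans (cong (_*ᶻ Q x) (ℤ.pos-+ (δ (b % p) x) (count B x)))
                                  (ℤ.*-distribʳ-+ (Q x) (+ δ (b % p) x) (+ count B x))) ⟩
    Σ< p (λ x → + δ (b % p) x *ᶻ Q x +ᶻ + count B x *ᶻ Q x)
      ≡⟨ Σ<-+ p (λ x → + δ (b % p) x *ᶻ Q x) (λ x → + count B x *ᶻ Q x) ⟩
    Σ< p (λ x → + δ (b % p) x *ᶻ Q x) +ᶻ Σ< p (λ x → + count B x *ᶻ Q x)
      ≡⟨ cong₂ _+ᶻ_ (Σ<-δ p (b % p) Q (m%n<n b p)) (Σ<-count B Q) ⟩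
    Q (b % p) +ᶻ ΣL B (λ b → Q (b % p))
      ∎
    where open ≡-Reasoning

  count-absent : ∀ B y → All (λ b → y ≢ b % p) B → count B y ≡ 0
  count-absent []      y []           = refl
  count-absent (b ∷ B) y (y≢b ∷ y∉B) = cong₂ _+_ (δ-≢ (λ b≡y → y≢b (sym b≡y))) (count-absent B y y∉B)

  count-0∨1 : ∀ {B} → Distinct B → ∀ y → count B y ≡ 0 ⊎ count B y ≡ 1
  count-0∨1 {[]}    []                  y = inj₁ refl
  count-0∨1 {b ∷ B} (b≢B ∷ distinct) y with b % p ℕ.≟ y
  ... | yes refl = inj₂ (cong₂ _+_ (δ-refl (b % p)) (count-absent B (b % p) b≢B))
  ... | no  b≢y with count-0∨1 distinct y
  ...   | inj₁ B∌y = inj₁ (cong₂ _+_ (δ-≢ b≢y) B∌y)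
  ...   | inj₂ B∋y = inj₂ (cong₂ _+_ (δ-≢ b≢y) B∋y)

  p∤1 : ¬ (+ p ∣ᶻ 1ℤ)
  p∤1 p∣1 = ¬prime[1] (subst (λ q → Prime (suc q)) n≡0 prime)
    where
    n≡0 : n ≡ 0
    n≡0 = ℕ.n≤0⇒n≡0 (ℕ.≤-pred (∣⇒≤ (ℤ∣.∣⇒∣ᵤ p∣1)))

  p∤Π< : ∀ k (f : ℕ → ℤ) → (∀ y → y < k → ¬ (+ p ∣ᶻ f y)) → ¬ (+ p ∣ᶻ Π< k f)
  p∤Π< zero    f p∤f = p∤1
  p∤Π< (suc k) f p∤f p∣Π with prime∣ᶻ-* prime (f 0) (Π< k (λ y → f (suc y))) p∣Π
  ... | inj₁ p∣f0 = p∤f 0 (s≤s z≤n) p∣f0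
  ... | inj₂ p∣Π′ = p∤Π< k (λ y → f (suc y)) (λ y y<k → p∤f (suc y) (s≤s y<k)) p∣Π′

  p∣^⇒p∣ : ∀ x k → + p ∣ᶻ x ℤ.^ k → + p ∣ᶻ x
  p∣^⇒p∣ x zero    p∣1 = ⊥-elim (p∤1 p∣1)
  p∣^⇒p∣ x (suc k) p∣xᵏ⁺¹ with prime∣ᶻ-* prime x (x ℤ.^ k) p∣xᵏ⁺¹
  ... | inj₁ p∣x  = p∣x
  ... | inj₂ p∣xᵏ = p∣^⇒p∣ x k p∣xᵏ

  module Weights (B : List ℕ) (distinct : Distinct B) where

    isZero : ℕ → ℕ
    isZero zero    = 1
    isZero (suc _) = 0

    factor : ℕ → ℕ → ℕ → ℤ
    factor zero    y x = + x - + y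
    factor (suc _) y x = 1ℤ

    u : ℕ → ℤ
    u x = Π< p (λ y → factor (count B y) y x)

    missing : ℕ
    missing = Σℕ< p (λ y → isZero (count B y))

    missing+length≡p : missing + length B ≡ p
    missing+length≡p = begin
      missing + length B
        ≡⟨ cong (λ s → missing + s) (sym (Σℕ<-count B)) ⟩
      missing + Σℕ< p (count B)
        ≡⟨ sym (Σℕ<-+ p (λ y → isZero (count B y)) (count B)) ⟩
      Σℕ< p (λ y → isZero (count B y) + count B y)
        ≡⟨ Σℕ<-cong p (λ y _ → isZero+id (count-0∨1 distinct y)) ⟩
      Σℕ< p (λ _ → 1)
        ≡⟨ trans (Σℕ<-const p 1) (ℕ.*-identityʳ p) ⟩
      p ∎
      where
      open ≡-Reasoning
      isZero+id : ∀ {c} → c ≡ 0 ⊎ c ≡ 1 → isZero c + c ≡ 1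
      isZero+id (inj₁ refl) = refl
      isZero+id (inj₂ refl) = refl

    u-vanishes : ∀ x → x < p → count B x ≡ 0 → u x ≡ 0ℤ
    u-vanishes x x<p B∌x = Π<-zero p (λ y → factor (count B y) y x) x x<p
      (trans (cong (λ c → factor c x x) B∌x) (ℤ.+-inverseʳ (+ x)))

    Deg<-u : Deg< (suc missing) u
    Deg<-u = ℕΔ.Deg<-Π< p (λ y → factor (count B y) y) (λ y → isZero (count B y)) (λ y → Deg<-factor (count B y) y)
      where
      Deg<-factor : ∀ c y → Deg< (suc (isZero c)) (factor c y)
      Deg<-factor zero    y     = ℕΔ.Deg<-linear y
      Deg<-factor (suc c) y g x = ∣ᶻ-0

    p∤u0 : count B 0 ≢ 0 → ¬ (+ p ∣ᶻ u 0)
    p∤u0 B∋0 = p∤Π< p (λ y → factor (count B y) y 0) p∤factor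
      where
      p∤factor : ∀ y → y < p → ¬ (+ p ∣ᶻ factor (count B y) y 0)
      p∤factor y y<p with count B y in eq
      ... | suc _ = p∤1
      p∤factor zero    y<p | zero = ⊥-elim (B∋0 eq)
      p∤factor (suc y) y<p | zero = λ p∣-y → ℕ.<⇒≱ y<p (∣⇒≤ (ℤ∣.∣⇒∣ᵤ (ℤ∣.∣m⇒∣-m p∣-y)))

    -- u(x) (x C k) has degree < p - 1, and such functions sum to 0 over a full period.
    ΣL-u-binomial : ∀ k → suc (missing + k) ≤ n → + p ∣ᶻ ΣL B (λ b → u b *ᶻ + (b C k))
    ΣL-u-binomial k bound = ∣ᶻ-resp-≡mod reindex (Deg<-Σ<-period {Q} Q<n)
      where
      Q : ℕ → ℤ
      Q x = u x *ᶻ + (x C k)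
      Q<n : Deg< n Q
      Q<n = ℕΔ.Deg<-mono bound (ℕΔ.Deg<-* missing k {u} {λ x → + (x C k)} Deg<-u (ℕΔ.Deg<-binomial k))
      Q<p : Deg< p Q
      Q<p = ℕΔ.Deg<-suc n {Q} Q<n
      supported : ∀ x → x < p → + count B x *ᶻ Q x ≡ Q x
      supported x x<p with count-0∨1 distinct x
      ... | inj₂ B∋x = trans (cong (λ c → + c *ᶻ Q x) B∋x) (ℤ.*-identityˡ (Q x))
      ... | inj₁ B∌x = begin
        + count B x *ᶻ Q x         ≡⟨ cong (λ c → + c *ᶻ Q x) B∌x ⟩
        0ℤ                         ≡⟨ sym (cong (_*ᶻ + (x C k)) (u-vanishes x x<p B∌x)) ⟩
        Q x                        ∎
        where open ≡-Reasoning
      reindex : ΣL B Q ≡ Σ< p Q mod + p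
      reindex = begin
        ΣL B Q                                 ≈⟨ ΣL-cong-mod B (Deg<p-≡mod-% {Q} Q<p) ⟩
        ΣL B (λ b → Q (b % p))                 ≡⟨ sym (Σ<-count B Q) ⟩
        Σ< p (λ x → + count B x *ᶻ Q x)        ≡⟨ Σ<-cong p supported ⟩
        Σ< p Q                                 ∎
        where open ≡mod-Reasoning (+ p)

-- The averaging operator

module Averaging (n : ℕ) (prime : Prime (suc n))
                 {D : Set} (_⊕_ : D → D → D) (⊕-swap : ∀ x g h → (x ⊕ g) ⊕ h ≡ (x ⊕ h) ⊕ g)
                 (B : List ℕ) (distinct : ModPrime.Distinct n prime B) (r : ℕ) (|B|≡1+r : length B ≡ suc r) where

  open ModPrime n prime using (p; module Weights)
  open Weights B distinct
  open FiniteDifference p _⊕_ ⊕-swap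

  average : D → (D → ℤ) → D → ℤ
  average g φ h = ΣL B (λ b → u b *ᶻ φ (h ⊕[ b ] g))

  γ : ℕ → ℤ
  γ k = ΣL B (λ b → u b *ᶻ + (b C k))

  missing+r≡n : missing + r ≡ n
  missing+r≡n = ℕ.suc-injective (begin
    suc (missing + r)  ≡⟨ sym (ℕ.+-suc missing r) ⟩
    missing + suc r    ≡⟨ cong (λ l → missing + l) (sym |B|≡1+r) ⟩
    missing + length B ≡⟨ missing+length≡p ⟩
    p                  ∎)
    where open ≡-Reasoning

  γ-vanishes : ∀ k → k < r → + p ∣ᶻ γ k
  γ-vanishes k k<r = ΣL-u-binomial k (subst₂ _≤_ (ℕ.+-suc missing k) missing+r≡n (ℕ.+-monoʳ-≤ missing k<r))

  Deg<-average : ∀ d g φ → Deg< (r + d) φ → Deg< d (average g φ)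
  Deg<-average d g φ φ<r+d =
    Deg<-resp d (λ h → ≡⇒≡mod (newton-ΣL u B (suc (sum B)) g φ h (All-<-suc-sum B)))
      (Deg<-Σ< d (suc (sum B)) (λ k h → γ k *ᶻ iterate (Δ g) φ k h) term<d)
    where
    term<d : ∀ k → Deg< d (λ h → γ k *ᶻ iterate (Δ g) φ k h)
    term<d k with k ℕ.<? r
    ... | yes k<r = Deg<-null d (λ h → ∣ᶻ-*ʳ (iterate (Δ g) φ k h) (γ-vanishes k k<r))
    ... | no  k≮r = Deg<-*ˡ d (γ k) (Deg<-iterate-Δ-≥ d g (ℕ.≮⇒≥ k≮r) φ<r+d)

-- Zero-sums in G

-- The two sides of ∈-tail and ∉-tail are instances of the local selector in the definition of ∑∈,
-- which cannot be named; they are fixed by the uses in ∑∈-∷.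
mutual
  ∑∈-∷ : ∀ {t} b (S : Subset t) (f : Fin (suc t) → ℕ) →
         ∑∈ (b ∷ S) f ≡ (if b then f zero else 0) + ∑∈ S (λ j → f (suc j))
  ∑∈-∷ inside  S f = cong (λ s → f zero + s) (cong Vec.sum (Vec.tabulate-cong (∈-tail S f)))
  ∑∈-∷ outside S f = cong Vec.sum (Vec.tabulate-cong (∉-tail S f))

  ∈-tail : ∀ {t} (S : Subset t) (f : Fin (suc t) → ℕ) (j : Fin t) → _≡_ {A = ℕ} _ _
  ∈-tail S f j with j ∈? S
  ... | yes _ = refl
  ... | no  _ = refl

  ∉-tail : ∀ {t} (S : Subset t) (f : Fin (suc t) → ℕ) (j : Fin t) → _≡_ {A = ℕ} _ _
  ∉-tail S f j with j ∈? S
  ... | yes _ = refl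
  ... | no  _ = refl

∑∈-⊥ : ∀ t (f : Fin t → ℕ) → ∑∈ (⊥ {t}) f ≡ 0
∑∈-⊥ zero    f = refl
∑∈-⊥ (suc t) f = trans (∑∈-∷ outside ⊥ f) (∑∈-⊥ t (λ j → f (suc j)))

m≤⌈m/n⌉*n : ∀ m r → m ≤ ⌈ m / suc r ⌉ * suc r
m≤⌈m/n⌉*n m r = ℕ.+-cancelʳ-≤ r m (q * suc r) (begin
  m + r                       ≡⟨ m≡m%n+[m/n]*n (m + r) (suc r) ⟩
  (m + r) % suc r + q * suc r ≤⟨ ℕ.+-monoˡ-≤ (q * suc r) (ℕ.≤-pred (m%n<n (m + r) (suc r))) ⟩
  r + q * suc r               ≡⟨ ℕ.+-comm r (q * suc r) ⟩
  q * suc r + r               ∎)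
  where
  open ℕ.≤-Reasoning
  q : ℕ
  q = (m + r) / suc r

1≤⌈m/n⌉ : ∀ m r → 1 ≤ m → 1 ≤ ⌈ m / suc r ⌉
1≤⌈m/n⌉ m r 1≤m = m≥n⇒m/n>0 {m + r} {suc r} (ℕ.+-monoˡ-≤ r 1≤m)

%≡%⇒∣∣-∣ : ∀ p .{{_ : NonZero p}} a b → a % p ≡ b % p → p ∣ ∣ a - b ∣
%≡%⇒∣∣-∣ p a b a%p≡b%p = divides ∣ a / p - b / p ∣ (begin
  ∣ a - b ∣
    ≡⟨ cong₂ ∣_-_∣ (m≡m%n+[m/n]*n a p) (trans (m≡m%n+[m/n]*n b p) (cong (_+ (b / p) * p) (sym a%p≡b%p))) ⟩
  ∣ a % p + (a / p) * p - a % p + (b / p) * p ∣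
    ≡⟨ ℕ.∣m+n-m+o∣≡∣n-o∣ (a % p) ((a / p) * p) ((b / p) * p) ⟩
  ∣ (a / p) * p - (b / p) * p ∣
    ≡⟨ sym (ℕ.*-distribʳ-∣-∣ p (a / p) (b / p)) ⟩
  ∣ a / p - b / p ∣ * p ∎)
  where open ≡-Reasoning

module ZeroSums (n : ℕ) (prime : Prime (suc n)) {l : ℕ} (e : Fin l → ℕ)
                (A : List ℕ) (distinct : ModPrime.Distinct n prime (0 ∷ A)) where

  open ModPrime n prime using (p; Deg<-𝟙∣ᵛ; p∣^⇒p∣; module Weights)
  open Weights (0 ∷ A) distinct using (u; p∤u0)
  open Averaging n prime (_⊕ᵛ_ {l}) ⊕ᵛ-swap (0 ∷ A) distinct (length A) refl using (average; Deg<-average)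
  open VecDifference p l using (Deg<; Deg<-mono; _⊕[_]_)

  vec : G p e → Vec ℕ l
  vec x = tabulate (λ i → toℕ (x i))

  𝟙₀ : Vec ℕ l → ℤ
  𝟙₀ = 𝟙∣ᵛ (λ i → p ^ e i)

  Cancels : ∀ t → (Fin t → G p e) → Vec ℕ l → Set
  Cancels t g h = Σ (Subset t) λ S → Nonempty S × Σ (Fin t → ℕ) λ a →
    ((j : Fin t) → j ∈ˢ S → a j ∈ˡ A) × ((i : Fin l) → p ^ e i ∣ lookup h i + ∑∈ S (λ j → a j * toℕ (g j i)))

  iterated : ∀ t → (Fin t → G p e) → Vec ℕ l → ℤ
  iterated zero    g = 𝟙₀
  iterated (suc t) g = average (vec (head g)) (iterated t (tail g))

  Deg<-iterated : ∀ t g d → Deg< (t * length A + d) 𝟙₀ → Deg< d (iterated t g)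
  Deg<-iterated zero    g d 𝟙₀<d = 𝟙₀<d
  Deg<-iterated (suc t) g d 𝟙₀<d = Deg<-average d (vec (head g)) (iterated t (tail g))
    (Deg<-iterated t (tail g) (length A + d) (subst (λ k → Deg< k 𝟙₀) (regroup t (length A) d) 𝟙₀<d))
    where
    regroup : ∀ t r d → (r + t * r) + d ≡ t * r + (r + d)
    regroup = ℕ-solve-∀

  module _ {t} (g : Fin (suc t) → G p e) (h : Vec ℕ l) where

    cancels-skip : Cancels t (tail g) h → Cancels (suc t) g h
    cancels-skip (S , (j , j∈S) , a , a∈A , cancel) = outside ∷ S , (suc j , there j∈S) , 0 ∷ᶠ a , a′∈A , cancel′
      where
      a′∈A : ∀ j → j ∈ˢ outside ∷ S → (0 ∷ᶠ a) j ∈ˡ A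
      a′∈A (suc j) (there j∈S) = a∈A j j∈S
      cancel′ : ∀ i → p ^ e i ∣ lookup h i + ∑∈ (outside ∷ S) (λ j → (0 ∷ᶠ a) j * toℕ (g j i))
      cancel′ i = subst (λ s → p ^ e i ∣ lookup h i + s) (sym (∑∈-∷ outside S _)) (cancel i)

    prepend : ∀ b (S : Subset t) a →
              (∀ i → p ^ e i ∣ lookup (h ⊕[ b ] vec (head g)) i + ∑∈ S (λ j → a j * toℕ (tail g j i))) →
              ∀ i → p ^ e i ∣ lookup h i + ∑∈ (inside ∷ S) (λ j → (b ∷ᶠ a) j * toℕ (g j i))
    prepend b S a cancel i = subst (p ^ e i ∣_) regroup (cancel i)
      where
      open ≡-Reasoning
      rest : ℕ
      rest = ∑∈ S (λ j → a j * toℕ (tail g j i))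
      regroup : lookup (h ⊕[ b ] vec (head g)) i + rest ≡ lookup h i + ∑∈ (inside ∷ S) (λ j → (b ∷ᶠ a) j * toℕ (g j i))
      regroup = begin
        lookup (h ⊕[ b ] vec (head g)) i + rest
          ≡⟨ cong (_+ rest) (lookup-⊕ᵛ[] {p} h b (vec (head g)) i) ⟩
        lookup h i + b * lookup (vec (head g)) i + rest
          ≡⟨ cong (λ y → lookup h i + b * y + rest) (Vec.lookup∘tabulate (λ i → toℕ (head g i)) i) ⟩
        lookup h i + b * toℕ (head g i) + rest
          ≡⟨ ℕ.+-assoc (lookup h i) (b * toℕ (head g i)) rest ⟩
        lookup h i + (b * toℕ (head g i) + rest)
          ≡⟨ cong (λ s → lookup h i + s) (sym (∑∈-∷ inside S (λ j → (b ∷ᶠ a) j * toℕ (g j i)))) ⟩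
        lookup h i + ∑∈ (inside ∷ S) (λ j → (b ∷ᶠ a) j * toℕ (g j i))
          ∎

    cancels-take : ∀ {b} → b ∈ˡ A → Cancels t (tail g) (h ⊕[ b ] vec (head g)) → Cancels (suc t) g h
    cancels-take {b} b∈A (S , (j , j∈S) , a , a∈A , cancel) =
      inside ∷ S , (suc j , there j∈S) , b ∷ᶠ a , a′∈A , prepend b S a cancel
      where
      a′∈A : ∀ j → j ∈ˢ inside ∷ S → (b ∷ᶠ a) j ∈ˡ A
      a′∈A zero    _           = b∈A
      a′∈A (suc j) (there j∈S) = a∈A j j∈S

    cancels-single : ∀ {b} → b ∈ˡ A → (∀ i → p ^ e i ∣ lookup (h ⊕[ b ] vec (head g)) i) → Cancels (suc t) g h
    cancels-single {b} b∈A zero-sum =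
      inside ∷ ⊥ , (zero , here) , b ∷ᶠ (λ _ → 0) , a′∈A , prepend b ⊥ (λ _ → 0) cancel
      where
      a′∈A : ∀ j → j ∈ˢ inside ∷ ⊥ → (b ∷ᶠ (λ _ → 0)) j ∈ˡ A
      a′∈A zero    _           = b∈A
      a′∈A (suc j) (there j∈⊥) = ⊥-elim (∉⊥ j∈⊥)
      cancel : ∀ i → p ^ e i ∣ lookup (h ⊕[ b ] vec (head g)) i + ∑∈ ⊥ (λ j → 0 * toℕ (tail g j i))
      cancel i = subst (λ s → p ^ e i ∣ lookup (h ⊕[ b ] vec (head g)) i + s) (sym (∑∈-⊥ t _))
                   (subst (p ^ e i ∣_) (sym (ℕ.+-identityʳ _)) (zero-sum i))

  -- Expanding the averages, every choice of weights other than all-zero contributes 0 modulo p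
  -- unless it already yields a zero-sum.
  mutual
    cancels-or-iterated : ∀ t g h → Cancels t g h ⊎ iterated t g h ≡ u 0 ℤ.^ t *ᶻ 𝟙₀ h mod + p
    cancels-or-iterated zero    g h = inj₂ (≡⇒≡mod (sym (ℤ.*-identityˡ (𝟙₀ h))))
    cancels-or-iterated (suc t) g h
      with cancels-or-iterated t (tail g) h
         | ΣL-≡0-or A u (λ a → iterated t (tail g) (h ⊕[ a ] vec (head g))) (cancels-or-vanishes t g h)
    ... | inj₁ cancels   | _           = inj₁ (cancels-skip g h cancels)
    ... | inj₂ _         | inj₁ cancels = inj₁ cancels
    ... | inj₂ iterated≡ | inj₂ rest≡0 =
      inj₂ (≡mod-trans (≡mod-+ (≡mod-*ˡ (u 0) iterated≡) rest≡0) (≡⇒≡mod (regroup (u 0) (u 0 ℤ.^ t) (𝟙₀ h))))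
      where
      regroup : ∀ u v z → u *ᶻ (v *ᶻ z) +ᶻ 0ℤ ≡ (u *ᶻ v) *ᶻ z
      regroup = solve-∀

    cancels-or-vanishes : ∀ t g h {a} → a ∈ˡ A →
      Cancels (suc t) g h ⊎ iterated t (tail g) (h ⊕[ a ] vec (head g)) ≡ 0ℤ mod + p
    cancels-or-vanishes t g h {a} a∈A
      with cancels-or-iterated t (tail g) (h ⊕[ a ] vec (head g)) | 𝟙∣ᵛ-cases (λ i → p ^ e i) (h ⊕[ a ] vec (head g))
    ... | inj₁ cancels   | _             = inj₁ (cancels-take g h a∈A cancels)
    ... | inj₂ _         | inj₂ zero-sum = inj₁ (cancels-single g h a∈A zero-sum)
    ... | inj₂ iterated≡ | inj₁ 𝟙₀≡0     =
      inj₂ (≡mod-trans iterated≡ (≡⇒≡mod (trans (cong (u 0 ℤ.^ t *ᶻ_) 𝟙₀≡0) (ℤ.*-zeroʳ (u 0 ℤ.^ t)))))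

  zero-sum-bound : ∀ N → suc (∑ (λ i → p ^ e i ∸ 1)) ≤ N * length A → DProp p e A N
  zero-sum-bound N bound g with cancels-or-iterated N g (replicate l 0)
  ... | inj₁ (S , nonempty , a , a∈A , cancel) = S , nonempty , a , a∈A , λ i →
        subst (λ z → p ^ e i ∣ z + ∑∈ S (λ j → a j * toℕ (g j i))) (Vec.lookup-replicate i 0) (cancel i)
  ... | inj₂ iterated≡ = ⊥-elim (p∤u0 (λ ()) (p∣^⇒p∣ (u 0) N p∣u0ᴺ))
    where
    p∣iterated : + p ∣ᶻ iterated N g (replicate l 0)
    p∣iterated = Deg<-iterated N g 0 (Deg<-mono {φ = 𝟙₀} bound′ (Deg<-𝟙∣ᵛ e)) (replicate l 0)
      where
      bound′ : suc (∑ (λ i → p ^ e i ∸ 1)) ≤ N * length A + 0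
      bound′ = subst (suc (∑ (λ i → p ^ e i ∸ 1)) ≤_) (sym (ℕ.+-identityʳ (N * length A))) bound
    u0ᴺ≡ : u 0 ℤ.^ N ≡ u 0 ℤ.^ N *ᶻ 𝟙₀ (replicate l 0)
    u0ᴺ≡ = sym (trans (cong (u 0 ℤ.^ N *ᶻ_) (𝟙∣ᵛ-replicate-0 (λ i → p ^ e i))) (ℤ.*-identityʳ (u 0 ℤ.^ N)))
    p∣u0ᴺ : + p ∣ᶻ u 0 ℤ.^ N
    p∣u0ᴺ = ∣ᶻ-resp-≡mod (≡mod-trans (≡⇒≡mod u0ᴺ≡) (≡mod-sym iterated≡)) p∣iterated

theorem1 : (p : ℕ) → Prime p → (k : ℕ) → (e : Fin (suc k) → ℕ) →
    ((i : Fin (suc k)) → 1 ≤ e i) →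
    ((i : Fin k) → e (inject₁ i) ≤ e (suc i)) →
    (A : List ℕ) → A ≢ [] →
    All (λ a → 1 ≤ a × a ≤ p ^ e (fromℕ k)) A →
    AllPairs (λ a b → ¬ (p ∣ ∣ a - b ∣)) A →
    All (λ a → ¬ (p ∣ a)) A →
    dA≤ p e A ⌈ 1 + ∑ (λ i → p ^ e i ∸ 1) / length A ⌉
theorem1 zero    pr = ⊥-elim (¬prime[0] pr)
theorem1 (suc n) pr k e _ _ []       []≢[] = ⊥-elim ([]≢[] refl)
theorem1 (suc n) pr k e _ _ (a ∷ as) _ _ incongruent coprime =
  N , 1≤⌈m/n⌉ D (length as) (s≤s z≤n) , ℕ.≤-refl ,
  ZeroSums.zero-sum-bound n pr e (a ∷ as) distinct N (m≤⌈m/n⌉*n D (length as))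
  where
  D N : ℕ
  D = 1 + ∑ (λ i → suc n ^ e i ∸ 1)
  N = ⌈ D / length (a ∷ as) ⌉
  distinct : ModPrime.Distinct n pr (0 ∷ a ∷ as)
  distinct = All.map (λ {b} p∤b 0≡b → p∤b (m%n≡0⇒n∣m b (suc n) (sym 0≡b))) coprime
           ∷ AllPairs.map (λ {b} {c} p∤b-c b≡c → p∤b-c (%≡%⇒∣∣-∣ (suc n) b c b≡c)) incongruent
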